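{- Let $L$ be a lattice such that $-\mathrm{id}_L\in\mathrm{W}(L)$. Then the root system $\mathrm{R}_2(L)$ has the same rank as $L$, and the abelian group $L^\sharp/L$ is killed by $2$.
   Context: A lattice is an integral Euclidean lattice (positive definite $\mathbb{Z}$-valued symmetric bilinear form $x\cdot y$) with dual $L^\sharp$. $\mathrm{R}_2(L)$ is the set of vectors of norm $2$ (roots) of $L$, and $\mathrm{W}(L)$ is the group generated by the reflections $s_\alpha(x)=x-(x\cdot\alpha)\alpha$, $\alpha\in\mathrm{R}_2(L)$. -}

module Defs where

open import Data.Nat using (ℕ; zero; suc)
open import Data.Fin using (Fin; zero; suc)
open import Data.Integer using (ℤ; +_; _+_; _*_; -_; _-_; _<_)
open import Data.Integer.Divisibility using (_∣_)
open import Data.List using (List; []; _∷_; foldr)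
open import Data.Product using (Σ; ∃; _×_; _,_; proj₁)
import Data.Product
open import Relation.Binary.PropositionalEquality using (_≡_; _≢_)

sumFin : (n : ℕ) → (Fin n → ℤ) → ℤ
sumFin zero    f = + 0
sumFin (suc n) f = f zero + sumFin n (λ i → f (suc i))

-- Vectors in ℤ^n (coordinates with respect to a ℤ-basis of the lattice)
Vect : ℕ → Set
Vect n = Fin n → ℤ

bil : (n : ℕ) → (Fin n → Fin n → ℤ) → Vect n → Vect n → ℤ
bil n G x y = sumFin n (λ i → sumFin n (λ j → x i * (G i j * y j)))

record Lattice : Set where
  field
    dim     : ℕ
    gram    : Fin dim → Fin dim → ℤ
    symm    : ∀ i j → gram i j ≡ gram j i
    posdef  : (x : Vect dim) → (Σ (Fin dim) λ i → x i ≢ + 0) → + 0 < bil dim gram x x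

open Lattice public

dot : (L : Lattice) → Vect (dim L) → Vect (dim L) → ℤ
dot L = bil (dim L) (gram L)

Root : Lattice → Set
Root L = Σ (Vect (dim L)) λ a → dot L a a ≡ + 2

refl : (L : Lattice) → Root L → Vect (dim L) → Vect (dim L)
refl L (a , _) x i = x i - dot L x a * a i

reflProd : (L : Lattice) → List (Root L) → Vect (dim L) → Vect (dim L)
reflProd L ws x = foldr (λ a y → refl L a y) x ws

-- -id_L ∈ W(L): W(L) is generated by the involutions s_α, so its elements
-- are exactly the finite products of reflections.
MinusIdInW : Lattice → Set
MinusIdInW L = Σ (List (Root L)) λ ws → ∀ x i → reflProd L ws x i ≡ - x i

combo : (L : Lattice) → List (ℤ × Root L) → Vect (dim L)
combo L cs i = foldr (λ p acc → proj₁ p * proj₁ (Data.Product.proj₂ p) i + acc) (+ 0) cs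

-- rank of the root system R₂(L) equals rank L (= dim L): the roots span
-- ℚ ⊗ L, i.e. every lattice vector has a nonzero multiple in ℤR₂(L).
RootsFullRank : Lattice → Set
RootsFullRank L = (x : Vect (dim L)) →
  Σ ℤ λ d → (d ≢ + 0) × (Σ (List (ℤ × Root L)) λ cs → ∀ i → d * x i ≡ combo L cs i)

-- x/d (x ∈ ℤⁿ, d ≥ 1) lies in L^♯ : (x/d)·y ∈ ℤ for all y ∈ L
InDual : (L : Lattice) → Vect (dim L) → ℕ → Set
InDual L x d = ∀ y → + (suc d) ∣ dot L x y

InLattice : (L : Lattice) → Vect (dim L) → ℕ → Set
InLattice L x d = ∀ i → + (suc d) ∣ x i

DualQuotientKilledBy2 : Lattice → Set
DualQuotientKilledBy2 L = ∀ x d → InDual L x d → InLattice L (λ i → + 2 * x i) d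

-- If w = s_{α₁} ⋯ s_{αₖ}, then x − w x = Σⱼ ((wⱼ x)·αⱼ) αⱼ, where wⱼ = s_{αⱼ₊₁} ⋯ s_{αₖ}.
-- For w = −id the left side is 2x, so 2x ∈ ℤR₂(L) for every x ∈ L. If moreover
-- x ∈ L^♯, then every wⱼ x ∈ L^♯ (reflections preserve L^♯), so the coefficients
-- (wⱼ x)·αⱼ are integers and 2x ∈ ℤR₂(L) ⊆ L.
module Submission where

open import Defs
open import Data.Nat using (zero; suc)
open import Data.Fin using (Fin; zero; suc)
open import Data.Integer using (ℤ; +_; _+_; _*_; -_; _-_)
open import Data.Integer.Divisibility.Signed
  using (_∣_; divides; ∣ᵤ⇒∣; ∣⇒∣ᵤ; ∣m∣n⇒∣m+n; ∣m∣n⇒∣m-n; ∣m⇒∣m*n)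
open import Data.Integer.Tactic.RingSolver using (solve-∀)
open import Data.List using (List; []; _∷_)
open import Data.List.Relation.Unary.All using (All; []; _∷_)
open import Data.Product using (_×_; _,_; proj₁)
open import Relation.Binary.PropositionalEquality
  using (_≡_; cong; cong₂; sym; subst; module ≡-Reasoning)
  renaming (refl to ≡-refl)
open ≡-Reasoning

sumFin-cong : ∀ n {f g : Fin n → ℤ} → (∀ i → f i ≡ g i) → sumFin n f ≡ sumFin n g
sumFin-cong zero    eq = ≡-refl
sumFin-cong (suc n) eq = cong₂ _+_ (eq zero) (sumFin-cong n (λ i → eq (suc i)))

sumFin-sub-* : ∀ n (f g : Fin n → ℤ) c →
  sumFin n (λ i → f i - c * g i) ≡ sumFin n f - c * sumFin n g
sumFin-sub-* zero f g c = zero≡zero-c*zero c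
  where
  zero≡zero-c*zero : ∀ c → + 0 ≡ + 0 - c * + 0
  zero≡zero-c*zero = solve-∀
sumFin-sub-* (suc n) f g c = begin
  f zero - c * g zero + sumFin n (λ i → f (suc i) - c * g (suc i))
    ≡⟨ cong (_+_ (f zero - c * g zero)) (sumFin-sub-* n (λ i → f (suc i)) (λ i → g (suc i)) c) ⟩
  f zero - c * g zero + (sumFin n (λ i → f (suc i)) - c * sumFin n (λ i → g (suc i)))
    ≡⟨ regroup (f zero) (g zero) _ _ c ⟩
  f zero + sumFin n (λ i → f (suc i)) - c * (g zero + sumFin n (λ i → g (suc i))) ∎
  where
  regroup : ∀ a b s t c → (a - c * b) + (s - c * t) ≡ (a + s) - c * (b + t)
  regroup = solve-∀

bil-sub-*ˡ : ∀ n G (y a z : Vect n) c →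
  bil n G (λ i → y i - c * a i) z ≡ bil n G y z - c * bil n G a z
bil-sub-*ˡ n G y a z c = begin
  sumFin n (λ i → sumFin n (λ j → (y i - c * a i) * (G i j * z j)))
    ≡⟨ sumFin-cong n (λ i → sumFin-cong n (λ j → distrib (y i) c (a i) (G i j * z j))) ⟩
  sumFin n (λ i → sumFin n (λ j → y i * (G i j * z j) - c * (a i * (G i j * z j))))
    ≡⟨ sumFin-cong n (λ i → sumFin-sub-* n _ _ c) ⟩
  sumFin n (λ i → sumFin n (λ j → y i * (G i j * z j)) - c * sumFin n (λ j → a i * (G i j * z j)))
    ≡⟨ sumFin-sub-* n _ _ c ⟩
  bil n G y z - c * bil n G a z ∎
  where
  distrib : ∀ y c a t → (y - c * a) * t ≡ y * t - c * (a * t)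
  distrib = solve-∀

module _ (L : Lattice) where

  reflCoeffs : List (Root L) → Vect (dim L) → List (ℤ × Root L)
  reflCoeffs []       x = []
  reflCoeffs (a ∷ ws) x = (dot L (reflProd L ws x) (proj₁ a) , a) ∷ reflCoeffs ws x

  sub-reflProd≡combo : ∀ ws x i → x i - reflProd L ws x i ≡ combo L (reflCoeffs ws x) i
  sub-reflProd≡combo []       x i = x-x≡0 (x i)
    where
    x-x≡0 : ∀ a → a - a ≡ + 0
    x-x≡0 = solve-∀
  sub-reflProd≡combo (a ∷ ws) x i = begin
    x i - (y i - c * proj₁ a i)  ≡⟨ regroup (x i) (y i) c (proj₁ a i) ⟩
    c * proj₁ a i + (x i - y i)  ≡⟨ cong (_+_ (c * proj₁ a i)) (sub-reflProd≡combo ws x i) ⟩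
    combo L (reflCoeffs (a ∷ ws) x) i ∎
    where
    y = reflProd L ws x
    c = dot L y (proj₁ a)
    regroup : ∀ x z c a → x - (z - c * a) ≡ c * a + (x - z)
    regroup = solve-∀

  combo-∣ : ∀ {k} cs → All (λ p → k ∣ proj₁ p) cs → ∀ i → k ∣ combo L cs i
  combo-∣ []             []         i = divides (+ 0) ≡-refl
  combo-∣ ((_ , a) ∷ cs) (k∣c ∷ ks) i = ∣m∣n⇒∣m+n (∣m⇒∣m*n (proj₁ a i) k∣c) (combo-∣ cs ks i)

  InDual-refl : ∀ {d} a y → InDual L y d → InDual L (refl L a y) d
  InDual-refl {d} (a , _) y y∈L♯ z
    rewrite bil-sub-*ˡ (dim L) (gram L) y a z (dot L y a) =
    ∣⇒∣ᵤ (∣m∣n⇒∣m-n (∣dot z) (∣m⇒∣m*n (dot L a z) (∣dot a)))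
    where
    ∣dot : ∀ v → + suc d ∣ dot L y v
    ∣dot v = ∣ᵤ⇒∣ (y∈L♯ v)

  InDual-reflProd : ∀ {d} ws y → InDual L y d → InDual L (reflProd L ws y) d
  InDual-reflProd []       y y∈L♯ = y∈L♯
  InDual-reflProd (a ∷ ws) y y∈L♯ = InDual-refl a (reflProd L ws y) (InDual-reflProd ws y y∈L♯)

  reflCoeffs-∣ : ∀ {d} ws y → InDual L y d → All (λ p → + suc d ∣ proj₁ p) (reflCoeffs ws y)
  reflCoeffs-∣ []       y y∈L♯ = []
  reflCoeffs-∣ (a ∷ ws) y y∈L♯ =
    ∣ᵤ⇒∣ (InDual-reflProd ws y y∈L♯ (proj₁ a)) ∷ reflCoeffs-∣ ws y y∈L♯

lemma2p2 : (L : Lattice) → MinusIdInW L → RootsFullRank L × DualQuotientKilledBy2 L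
lemma2p2 L (ws , w≡-id) = rootsFullRank , killedBy2
  where
  twice≡combo : ∀ x i → + 2 * x i ≡ combo L (reflCoeffs L ws x) i
  twice≡combo x i = begin
    + 2 * x i                ≡⟨ two*≡sub-neg (x i) ⟩
    x i - - x i              ≡⟨ cong (_-_ (x i)) (sym (w≡-id x i)) ⟩
    x i - reflProd L ws x i  ≡⟨ sub-reflProd≡combo L ws x i ⟩
    combo L (reflCoeffs L ws x) i ∎
    where
    two*≡sub-neg : ∀ a → + 2 * a ≡ a - - a
    two*≡sub-neg = solve-∀

  rootsFullRank : RootsFullRank L
  rootsFullRank x = + 2 , (λ ()) , reflCoeffs L ws x , twice≡combo x

  killedBy2 : DualQuotientKilledBy2 L
  killedBy2 x d x∈L♯ i =
    ∣⇒∣ᵤ (subst (_ ∣_) (sym (twice≡combo x i)) (combo-∣ L _ (reflCoeffs-∣ L ws x x∈L♯) i))
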